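{- If $\sigma$ is a confined chip configuration on $K_n$ and $t\ge0$, then $U^t\sigma=\sigma$ if and only if $n$ divides $\alpha_t=\sum_{s=0}^{t-1}r(U^s\sigma)$.
   Context: Parallel chip-firing on $K_n$: $\sigma:[n]\to\mathbb{Z}_{\ge0}$, $r(\sigma)=\#\{v:\sigma(v)\ge n\}$, $U\sigma(v)=\sigma(v)+r(\sigma)$ if $\sigma(v)\le n-1$, $U\sigma(v)=\sigma(v)-n+r(\sigma)$ if $\sigma(v)\ge n$. $\sigma$ is confined if $\sigma(v)\le 2n-1$ for all $v$ and $\max_v\sigma(v)-\min_v\sigma(v)\le n-1$. -}

module Defs where

open import Data.Nat using (ℕ; zero; suc; _+_; _∸_; _≤_; _≤ᵇ_)
open import Data.Fin using (Fin)
open import Data.Bool using (if_then_else_)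
open import Data.List using (List; length; filter; map; upTo)
open import Data.Nat.ListAction using (sum)
open import Data.List using () renaming (allFin to allFinL)
open import Data.Nat.Properties using (_≤?_)
open import Data.Product using (_×_; ∃-syntax)

Config : ℕ → Set
Config n = Fin n → ℕ

r : ∀ {n} → Config n → ℕ
r {n} σ = length (filter (λ v → n ≤? σ v) (allFinL n))

U : ∀ {n} → Config n → Config n
U {n} σ v = if n ≤ᵇ σ v then (σ v ∸ n) + r σ else σ v + r σ

U^ : ∀ {n} → ℕ → Config n → Config n
U^ zero σ = σ
U^ (suc t) σ = U (U^ t σ)

α : ∀ {n} → Config n → ℕ → ℕ
α σ t = sum (map (λ s → r (U^ s σ)) (upTo t))

-- σ is confined: σ(v) ≤ 2n-1 for all v, and max σ - min σ ≤ n-1,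
-- i.e. σ(v) ≤ σ(w) + (n-1) for all v, w.
Confined : ∀ {n} → Config n → Set
Confined {n} σ = (∀ v → σ v ≤ 2 Data.Nat.* n ∸ 1) × (∀ v w → σ v ≤ σ w + (n ∸ 1))

-- Each step adds r(σ) chips to every vertex and removes n from each firing vertex, so
-- U^t σ v + n·f_t(v) = σ v + α_t, where f_t(v) counts the firings of v before time t.
-- Hence U^t σ = σ forces n ∣ α_t, and conversely n ∣ α_t makes every U^t σ v congruent to σ v
-- modulo n. Confinement is preserved by U, and two confined configurations congruent modulo n
-- cannot have one vertex ahead by n or more and another behind by n or more; so one dominates
-- the other pointwise, and as U conserves the total number of chips they coincide.
module Submission where

open import Defs
open import Data.Nat using (ℕ; zero; suc; _+_; _*_; _∸_; _≤_; _<_; _≤ᵇ_; z≤n)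
open import Data.Nat.Properties
open import Data.Nat.Divisibility using (_∣_; divides)
open import Data.Nat.ListAction using (sum)
open import Data.Nat.ListAction.Properties using (sum-++)
open import Data.Fin as Fin using (Fin)
open import Data.Fin.Properties using (all?; ¬∀⟶∃¬)
open import Data.Bool using (true; false; T; if_then_else_)
open import Data.List using ([]; _∷_; [_]; _++_; length; filter; map; upTo)
open import Data.List using () renaming (allFin to allFinL)
open import Data.List.Properties using (length-filter; length-tabulate; map-++; upTo-∷ʳ)
open import Data.List.Membership.Propositional using (_∈_)
open import Data.List.Membership.Propositional.Properties using (∈-allFin)
open import Data.List.Relation.Unary.Any using (here; there)
open import Data.Product using (_×_; _,_; ∃-syntax)
open import Data.Sum using (_⊎_; inj₁; inj₂; [_,_]′)
open import Data.Empty using (⊥; ⊥-elim)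
open import Function using (_∘_)
open import Relation.Binary.PropositionalEquality
  using (_≡_; refl; sym; trans; cong; cong₂; subst; module ≡-Reasoning)
open import Relation.Nullary using (¬_; yes; no; does)
open import Relation.Unary using (Decidable)
open import Algebra.Properties.CommutativeSemigroup +-commutativeSemigroup
  using (interchange; x∙yz≈xz∙y; xy∙z≈xz∙y)

+-≡⇒≡ˡ : ∀ {a b c d} → a ≤ b → c ≤ d → a + c ≡ b + d → a ≡ b
+-≡⇒≡ˡ {a} {b} {c} {d} a≤b c≤d eq =
  ≤-antisym a≤b (+-cancelʳ-≤ c b a (≤-trans (+-monoʳ-≤ b c≤d) (≤-reflexive (sym eq))))

+-≡⇒≡ʳ : ∀ {a b c d} → a ≤ b → c ≤ d → a + c ≡ b + d → c ≡ d
+-≡⇒≡ʳ {a} {b} {c} {d} a≤b c≤d eq =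
  +-≡⇒≡ˡ c≤d a≤b (trans (+-comm c a) (trans eq (+-comm b d)))

sum-map-mono : ∀ {A : Set} {f g : A → ℕ} → (∀ x → f x ≤ g x) →
               ∀ xs → sum (map f xs) ≤ sum (map g xs)
sum-map-mono f≤g []       = z≤n
sum-map-mono f≤g (x ∷ xs) = +-mono-≤ (f≤g x) (sum-map-mono f≤g xs)

sum-map-≡⇒∈-≡ : ∀ {A : Set} {f g : A → ℕ} → (∀ x → f x ≤ g x) →
                ∀ {xs} → sum (map f xs) ≡ sum (map g xs) → ∀ {x} → x ∈ xs → f x ≡ g x
sum-map-≡⇒∈-≡ f≤g {y ∷ xs} eq (here refl)  = +-≡⇒≡ˡ (f≤g y) (sum-map-mono f≤g xs) eq
sum-map-≡⇒∈-≡ f≤g {y ∷ xs} eq (there x∈xs) =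
  sum-map-≡⇒∈-≡ f≤g (+-≡⇒≡ʳ (f≤g y) (sum-map-mono f≤g xs) eq) x∈xs

sum-map-linear : ∀ {A : Set} (f g h : A → ℕ) c k → (∀ x → f x + c * g x ≡ h x + k) →
                 ∀ xs → sum (map f xs) + c * sum (map g xs) ≡ sum (map h xs) + length xs * k
sum-map-linear f g h c k eq []       = *-zeroʳ c
sum-map-linear f g h c k eq (x ∷ xs) = begin
  (f x + F) + c * (g x + G)       ≡⟨ cong ((f x + F) +_) (*-distribˡ-+ c (g x) G) ⟩
  (f x + F) + (c * g x + c * G)   ≡⟨ interchange (f x) F (c * g x) (c * G) ⟩
  (f x + c * g x) + (F + c * G)   ≡⟨ cong₂ _+_ (eq x) (sum-map-linear f g h c k eq xs) ⟩
  (h x + k) + (H + length xs * k) ≡⟨ interchange (h x) k H (length xs * k) ⟩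
  (h x + H) + (k + length xs * k) ∎
  where
  open ≡-Reasoning
  F = sum (map f xs)
  G = sum (map g xs)
  H = sum (map h xs)

sum-upTo-suc : ∀ (f : ℕ → ℕ) t → sum (map f (upTo (suc t))) ≡ sum (map f (upTo t)) + f t
sum-upTo-suc f t = begin
  sum (map f (upTo (suc t)))         ≡⟨ cong (sum ∘ map f) (sym (upTo-∷ʳ t)) ⟩
  sum (map f (upTo t ++ [ t ]))      ≡⟨ cong sum (map-++ f (upTo t) [ t ]) ⟩
  sum (map f (upTo t) ++ [ f t ])    ≡⟨ sum-++ (map f (upTo t)) [ f t ] ⟩
  sum (map f (upTo t)) + (f t + 0)   ≡⟨ cong (sum (map f (upTo t)) +_) (+-identityʳ (f t)) ⟩
  sum (map f (upTo t)) + f t         ∎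
  where open ≡-Reasoning

fired : ∀ {n} → Config n → Fin n → ℕ
fired {n} σ v = if n ≤ᵇ σ v then 1 else 0

fire-step : ∀ n x k →
  (if n ≤ᵇ x then x ∸ n + k else x + k) + n * (if n ≤ᵇ x then 1 else 0) ≡ x + k
fire-step n x k with n ≤ᵇ x in fires
... | false = trans (cong (x + k +_) (*-zeroʳ n)) (+-identityʳ (x + k))
... | true  = begin
  (x ∸ n + k) + n * 1   ≡⟨ cong (x ∸ n + k +_) (*-identityʳ n) ⟩
  (x ∸ n + k) + n       ≡⟨ xy∙z≈xz∙y (x ∸ n) k n ⟩
  (x ∸ n + n) + k       ≡⟨ cong (_+ k) (m∸n+n≡m (≤ᵇ⇒≤ n x (subst T (sym fires) _))) ⟩
  x + k                 ∎
  where open ≡-Reasoning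

U-step : ∀ {n} (σ : Config n) v → U σ v + n * fired σ v ≡ σ v + r σ
U-step {n} σ v = fire-step n (σ v) (r σ)

length-filter≡sum-indicator : ∀ {A : Set} {P : A → Set} (P? : Decidable P) xs →
  length (filter P? xs) ≡ sum (map (λ x → if does (P? x) then 1 else 0) xs)
length-filter≡sum-indicator P? []       = refl
length-filter≡sum-indicator P? (x ∷ xs) with does (P? x)
... | true  = cong suc (length-filter≡sum-indicator P? xs)
... | false = length-filter≡sum-indicator P? xs

r≡sum-fired : ∀ {n} (σ : Config n) → r σ ≡ sum (map (fired σ) (allFinL n))
r≡sum-fired {n} σ = length-filter≡sum-indicator (λ v → n ≤? σ v) (allFinL n)

length-allFin : ∀ n → length (allFinL n) ≡ n
length-allFin n = length-tabulate {n = n} (λ v → v)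

r≤n : ∀ {n} (σ : Config n) → r σ ≤ n
r≤n {n} σ = ≤-trans (length-filter (λ v → n ≤? σ v) (allFinL n)) (≤-reflexive (length-allFin n))

total : ∀ {n} → Config n → ℕ
total {n} σ = sum (map σ (allFinL n))

total-U : ∀ {n} (σ : Config n) → total (U σ) ≡ total σ
total-U {n} σ = +-cancelʳ-≡ (n * r σ) (total (U σ)) (total σ) (begin
  total (U σ) + n * r σ                   ≡⟨ cong (λ k → total (U σ) + n * k) (r≡sum-fired σ) ⟩
  total (U σ) + n * sum (map (fired σ) V) ≡⟨ sum-map-linear (U σ) (fired σ) σ n (r σ) (U-step σ) V ⟩
  total σ + length V * r σ                ≡⟨ cong (λ k → total σ + k * r σ) (length-allFin n) ⟩
  total σ + n * r σ                       ∎)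
  where
  open ≡-Reasoning
  V = allFinL n

U^-preserves : ∀ {n} (P : Config n → Set) → (∀ σ → P σ → P (U σ)) →
               ∀ {σ} → P σ → ∀ t → P (U^ t σ)
U^-preserves P step p zero    = p
U^-preserves P step p (suc t) = step _ (U^-preserves P step p t)

total-U^ : ∀ {n} (σ : Config n) t → total (U^ t σ) ≡ total σ
total-U^ σ = U^-preserves (λ τ → total τ ≡ total σ) (λ τ eq → trans (total-U τ) eq) {σ} refl

firings : ∀ {n} → Config n → ℕ → Fin n → ℕ
firings σ t v = sum (map (λ s → fired (U^ s σ) v) (upTo t))

U^-chips : ∀ {n} (σ : Config n) t v → U^ t σ v + n * firings σ t v ≡ σ v + α σ t
U^-chips {n} σ zero    v = cong (σ v +_) (*-zeroʳ n)
U^-chips {n} σ (suc t) v = begin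
  U τ v + n * firings σ (suc t) v   ≡⟨ cong (λ k → U τ v + n * k) (sum-upTo-suc fired-at t) ⟩
  U τ v + n * (f + fired τ v)       ≡⟨ cong (U τ v +_) (*-distribˡ-+ n f (fired τ v)) ⟩
  U τ v + (n * f + n * fired τ v)   ≡⟨ x∙yz≈xz∙y (U τ v) (n * f) (n * fired τ v) ⟩
  (U τ v + n * fired τ v) + n * f   ≡⟨ cong (_+ n * f) (U-step τ v) ⟩
  (τ v + r τ) + n * f               ≡⟨ xy∙z≈xz∙y (τ v) (r τ) (n * f) ⟩
  (τ v + n * f) + r τ               ≡⟨ cong (_+ r τ) (U^-chips σ t v) ⟩
  (σ v + α σ t) + r τ               ≡⟨ +-assoc (σ v) (α σ t) (r τ) ⟩
  σ v + (α σ t + r τ)               ≡⟨ cong (σ v +_) (sym (sum-upTo-suc (λ s → r (U^ s σ)) t)) ⟩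
  σ v + α σ (suc t)                 ∎
  where
  open ≡-Reasoning
  τ = U^ t σ
  f = firings σ t v
  fired-at : ℕ → ℕ
  fired-at s = fired (U^ s σ) v

fire-≤ : ∀ m x k → x ≤ m + suc m → (if suc m ≤ᵇ x then x ∸ suc m + k else x + k) ≤ m + k
fire-≤ m x k x≤ with suc m ≤ᵇ x in fires
... | true  = +-monoˡ-≤ k (≤-trans (∸-monoˡ-≤ (suc m) x≤) (≤-reflexive (m+n∸n≡m m (suc m))))
... | false = +-monoˡ-≤ k (≤-pred (≰⇒> (λ 1+m≤x → subst T fires (≤⇒≤ᵇ 1+m≤x))))

fire-≥ : ∀ n x k → k ≤ (if n ≤ᵇ x then x ∸ n + k else x + k)
fire-≥ n x k with n ≤ᵇ x
... | true  = m≤n+m k (x ∸ n)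
... | false = m≤n+m k x

2*[1+m]∸1≡m+[1+m] : ∀ m → 2 * suc m ∸ 1 ≡ m + suc m
2*[1+m]∸1≡m+[1+m] m = cong (λ k → m + suc k) (+-identityʳ m)

U-Confined : ∀ {n} (σ : Config n) → Confined σ → Confined (U σ)
U-Confined {zero}  σ _            = (λ ()) , (λ ())
U-Confined {suc m} σ (bound , gap) = U-bound , U-gap
  where
  U≤m+r : ∀ v → U σ v ≤ m + r σ
  U≤m+r v = fire-≤ m (σ v) (r σ) (≤-trans (bound v) (≤-reflexive (2*[1+m]∸1≡m+[1+m] m)))
  U-bound : ∀ v → U σ v ≤ 2 * suc m ∸ 1
  U-bound v = ≤-trans (U≤m+r v)
    (≤-trans (+-monoʳ-≤ m (r≤n σ)) (≤-reflexive (sym (2*[1+m]∸1≡m+[1+m] m))))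
  U-gap : ∀ v w → U σ v ≤ U σ w + m
  U-gap v w = ≤-trans (U≤m+r v)
    (≤-trans (+-monoʳ-≤ m (fire-≥ (suc m) (σ w) (r σ))) (≤-reflexive (+-comm m (U σ w))))

-- Congruence modulo n, stated without subtraction or division.
data _≡_[mod_] (a b n : ℕ) : Set where
  congruent : ∀ f g → a + n * f ≡ b + n * g → a ≡ b [mod n ]

≡mod-sym : ∀ {a b n} → a ≡ b [mod n ] → b ≡ a [mod n ]
≡mod-sym (congruent f g eq) = congruent g f (sym eq)

≡mod-<⇒+n≤ : ∀ {a b n} → a ≡ b [mod n ] → b < a → b + n ≤ a
≡mod-<⇒+n≤ {a} {b} {n} (congruent f g eq) b<a = +-cancelʳ-≤ (n * f) (b + n) a (begin
  b + n + n * f    ≡⟨ +-assoc b n (n * f) ⟩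
  b + (n + n * f)  ≡⟨ cong (b +_) (sym (*-suc n f)) ⟩
  b + n * suc f    ≤⟨ +-monoʳ-≤ b (*-monoʳ-≤ n f<g) ⟩
  b + n * g        ≡⟨ sym eq ⟩
  a + n * f        ∎)
  where
  open ≤-Reasoning
  f<g : f < g
  f<g = ≰⇒> λ g≤f → <⇒≱ b<a (+-cancelʳ-≤ (n * g) a b (begin
    a + n * g  ≤⟨ +-monoʳ-≤ a (*-monoʳ-≤ n g≤f) ⟩
    a + n * f  ≡⟨ eq ⟩
    b + n * g  ∎))

Confined-no-crossing : ∀ {m} {σ τ : Config (suc m)} → Confined σ → Confined τ →
  ∀ v w → σ v + suc m ≤ τ v → τ w + suc m ≤ σ w → ⊥
Confined-no-crossing {m} {σ} {τ} (_ , σ-gap) (_ , τ-gap) v w σv+n≤τv τw+n≤σw =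
  <-irrefl refl (begin-strict
  σ w          ≤⟨ σ-gap w v ⟩
  σ v + m      <⟨ +-monoʳ-< (σ v) (n<1+n m) ⟩
  σ v + suc m  ≤⟨ σv+n≤τv ⟩
  τ v          ≤⟨ τ-gap v w ⟩
  τ w + m      <⟨ +-monoʳ-< (τ w) (n<1+n m) ⟩
  τ w + suc m  ≤⟨ τw+n≤σw ⟩
  σ w          ∎)
  where open ≤-Reasoning

Confined-≡mod⇒comparable : ∀ {m} {σ τ : Config (suc m)} → Confined σ → Confined τ →
  (∀ v → τ v ≡ σ v [mod suc m ]) → (∀ v → τ v ≤ σ v) ⊎ (∀ v → σ v ≤ τ v)
Confined-≡mod⇒comparable {m} {σ} {τ} cσ cτ τ≡σ with all? (λ v → τ v ≤? σ v)
... | yes τ≤σ = inj₁ τ≤σ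
... | no  τ≰σ = inj₂ (σ≤τ (¬∀⟶∃¬ (suc m) _ (λ v → τ v ≤? σ v) τ≰σ))
  where
  σ≤τ : ∃[ w ] ¬ τ w ≤ σ w → ∀ v → σ v ≤ τ v
  σ≤τ (w , τw≰σw) v with σ v ≤? τ v
  ... | yes σv≤τv = σv≤τv
  ... | no  σv≰τv = ⊥-elim (Confined-no-crossing cσ cτ w v
    (≡mod-<⇒+n≤ (τ≡σ w) (≰⇒> τw≰σw)) (≡mod-<⇒+n≤ (≡mod-sym (τ≡σ v)) (≰⇒> σv≰τv)))

total-≡∧≤⇒≡ : ∀ {n} {σ τ : Config n} → (∀ v → σ v ≤ τ v) → total σ ≡ total τ →
              ∀ v → σ v ≡ τ v
total-≡∧≤⇒≡ σ≤τ eq v = sum-map-≡⇒∈-≡ σ≤τ eq (∈-allFin v)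

U^-fixed⇒∣α : ∀ {n} (σ : Config n) t v → U^ t σ v ≡ σ v → n ∣ α σ t
U^-fixed⇒∣α {n} σ t v fixed = divides f (begin
  α σ t  ≡⟨ +-cancelˡ-≡ (σ v) _ _ (trans (sym (U^-chips σ t v)) (cong (_+ n * f) fixed)) ⟩
  n * f  ≡⟨ *-comm n f ⟩
  f * n  ∎)
  where
  open ≡-Reasoning
  f = firings σ t v

∣α⇒U^-≡mod : ∀ {n} (σ : Config n) t → n ∣ α σ t → ∀ v → U^ t σ v ≡ σ v [mod n ]
∣α⇒U^-≡mod {n} σ t (divides q α≡qn) v =
  congruent (firings σ t v) q
    (trans (U^-chips σ t v) (cong (σ v +_) (trans α≡qn (*-comm q n))))

α-K₀ : (σ : Config 0) (t : ℕ) → α σ t ≡ 0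
α-K₀ σ zero    = refl
α-K₀ σ (suc t) = trans (sum-upTo-suc (λ s → r (U^ s σ)) t)
                       (trans (+-identityʳ (α σ t)) (α-K₀ σ t))

lemma4p5 : (n : ℕ) (σ : Config n) → Confined σ → (t : ℕ) →
    ((∀ v → U^ t σ v ≡ σ v) → n ∣ α σ t) × (n ∣ α σ t → ∀ v → U^ t σ v ≡ σ v)
lemma4p5 zero    σ _ t = (λ _ → divides 0 (α-K₀ σ t)) , (λ _ ())
lemma4p5 (suc m) σ c t = (λ fixed → U^-fixed⇒∣α σ t Fin.zero (fixed Fin.zero)) , periodic
  where
  periodic : suc m ∣ α σ t → ∀ v → U^ t σ v ≡ σ v
  periodic n∣α = [ (λ τ≤σ → total-≡∧≤⇒≡ τ≤σ (total-U^ σ t))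
                 , (λ σ≤τ v → sym (total-≡∧≤⇒≡ σ≤τ (sym (total-U^ σ t)) v))
                 ]′ (Confined-≡mod⇒comparable c (U^-preserves Confined U-Confined c t)
                                               (∣α⇒U^-≡mod σ t n∣α))
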